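{- A self-complementary split graph has a rectangle partition if and only if it is isomorphic to $Z_k$ for some positive integer $k$.
   Context: Graphs are finite and simple. A graph is self-complementary if it is isomorphic to its complement. A split graph is a graph whose vertex set can be partitioned into a clique and an independent set. A rectangle partition of $G$ is a partition of $V(G)$ into four nonempty sets $V_1,V_2,V_3,V_4$ such that $V_1$ is complete to $V_2$ and has no edges to $V_3$, while $V_4$ is complete to $V_3$ and has no edges to $V_2$ ("complete" meaning all possible edges between the two sets are present). For a positive integer $k$, $Z_k$ is the graph obtained from the path $a\!-\!b\!-\!c\!-\!d$ by replacing each of $a,d$ with an independent set of $k$ vertices and each of $b,c$ with a clique of $k$ vertices, where two of the new sets are complete to each other if the corresponding path vertices are adjacent and have no edges between them otherwise. -}

module Defs where

open import Level using (0ℓ)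
open import Data.Nat using (ℕ; zero; suc; _+_; _*_; _<_)
open import Data.Fin using (Fin; zero; suc)
open import Data.Product using (_×_; _,_; ∃; Σ; proj₁; proj₂)
open import Data.Empty using (⊥)
open import Data.Unit using (⊤)
open import Relation.Nullary using (¬_)
open import Relation.Binary.PropositionalEquality using (_≡_)
open import Function.Bundles using (_⤖_; Bijection; _⇔_)

record Graph (V : Set) : Set₁ where
  field
    Adj   : V → V → Set
    sym   : ∀ {u v} → Adj u v → Adj v u
    irrefl : ∀ {v} → ¬ Adj v v

open Graph public

FinGraph : ℕ → Set₁
FinGraph n = Graph (Fin n)

complement : ∀ {V} → Graph V → Graph V
complement G = record
  { Adj = λ u v → ¬ (u ≡ v) × ¬ Adj G u v
  ; sym = λ { (ne , na) → (λ e → ne (Relation.Binary.PropositionalEquality.sym e))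
                          , (λ a → na (Graph.sym G a)) }
  ; irrefl = λ { (ne , _) → ne Relation.Binary.PropositionalEquality.refl }
  }

_≅_ : ∀ {V W} → Graph V → Graph W → Set
_≅_ {V} {W} G H =
  Σ (V ⤖ W) λ f → ∀ u v → Adj G u v ⇔ Adj H (Bijection.to f u) (Bijection.to f v)

SelfComplementary : ∀ {V} → Graph V → Set
SelfComplementary G = G ≅ complement G

data Side : Set where
  clique indep : Side

IsSplit : ∀ {V} → Graph V → Set
IsSplit {V} G = Σ (V → Side) λ s →
    (∀ u v → s u ≡ clique → s v ≡ clique → ¬ (u ≡ v) → Adj G u v)
  × (∀ u v → s u ≡ indep → s v ≡ indep → ¬ Adj G u v)

-- Rectangle partition: V₁,V₂,V₃,V₄ nonempty, encoded by a labelling p : V → Fin 4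
-- (label 0 ↦ V₁, 1 ↦ V₂, 2 ↦ V₃, 3 ↦ V₄).
v1 v2 v3 v4 : Fin 4
v1 = zero
v2 = suc zero
v3 = suc (suc zero)
v4 = suc (suc (suc zero))

HasRectanglePartition : ∀ {V} → Graph V → Set
HasRectanglePartition {V} G = Σ (V → Fin 4) λ p →
    (∀ i → ∃ λ v → p v ≡ i)
  × (∀ u v → p u ≡ v1 → p v ≡ v2 → Adj G u v)
  × (∀ u v → p u ≡ v1 → p v ≡ v3 → ¬ Adj G u v)
  × (∀ u v → p u ≡ v4 → p v ≡ v3 → Adj G u v)
  × (∀ u v → p u ≡ v4 → p v ≡ v2 → ¬ Adj G u v)

-- Z_k on vertex set Fin 4 × Fin k: block 0 = a (independent), 1 = b (clique),
-- 2 = c (clique), 3 = d (independent); path a-b-c-d.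
ZAdj : ∀ {k} → Fin 4 × Fin k → Fin 4 × Fin k → Set
ZAdj (zero , _) (zero , _) = ⊥
ZAdj (zero , _) (suc zero , _) = ⊤
ZAdj (zero , _) (suc (suc _) , _) = ⊥
ZAdj (suc zero , _) (zero , _) = ⊤
ZAdj (suc zero , i) (suc zero , j) = ¬ (i ≡ j)
ZAdj (suc zero , _) (suc (suc zero) , _) = ⊤
ZAdj (suc zero , _) (suc (suc (suc _)) , _) = ⊥
ZAdj (suc (suc zero) , _) (zero , _) = ⊥
ZAdj (suc (suc zero) , _) (suc zero , _) = ⊤
ZAdj (suc (suc zero) , i) (suc (suc zero) , j) = ¬ (i ≡ j)
ZAdj (suc (suc zero) , _) (suc (suc (suc _)) , _) = ⊤
ZAdj (suc (suc (suc _)) , _) (suc (suc zero) , _) = ⊤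
ZAdj (suc (suc (suc _)) , _) (zero , _) = ⊥
ZAdj (suc (suc (suc _)) , _) (suc zero , _) = ⊥
ZAdj (suc (suc (suc _)) , _) (suc (suc (suc _)) , _) = ⊥

private
  open import Relation.Binary.PropositionalEquality as P using ()
  ZAdj-sym : ∀ {k} {u v : Fin 4 × Fin k} → ZAdj u v → ZAdj v u
  ZAdj-sym {u = zero , _} {zero , _} ()
  ZAdj-sym {u = zero , _} {suc zero , _} a = _
  ZAdj-sym {u = zero , _} {suc (suc zero) , _} ()
  ZAdj-sym {u = zero , _} {suc (suc (suc _)) , _} ()
  ZAdj-sym {u = suc zero , _} {zero , _} a = _
  ZAdj-sym {u = suc zero , _} {suc zero , _} a = λ e → a (P.sym e)
  ZAdj-sym {u = suc zero , _} {suc (suc zero) , _} a = _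
  ZAdj-sym {u = suc zero , _} {suc (suc (suc _)) , _} ()
  ZAdj-sym {u = suc (suc zero) , _} {zero , _} ()
  ZAdj-sym {u = suc (suc zero) , _} {suc zero , _} a = _
  ZAdj-sym {u = suc (suc zero) , _} {suc (suc zero) , _} a = λ e → a (P.sym e)
  ZAdj-sym {u = suc (suc zero) , _} {suc (suc (suc _)) , _} a = _
  ZAdj-sym {u = suc (suc (suc _)) , _} {zero , _} ()
  ZAdj-sym {u = suc (suc (suc _)) , _} {suc zero , _} ()
  ZAdj-sym {u = suc (suc (suc _)) , _} {suc (suc zero) , _} a = _
  ZAdj-sym {u = suc (suc (suc _)) , _} {suc (suc (suc _)) , _} ()

  ZAdj-irr : ∀ {k} {v : Fin 4 × Fin k} → ¬ ZAdj v v
  ZAdj-irr {v = zero , _} ()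
  ZAdj-irr {v = suc zero , _} a = a P.refl
  ZAdj-irr {v = suc (suc zero) , _} a = a P.refl
  ZAdj-irr {v = suc (suc (suc _)) , _} ()

Z : (k : ℕ) → Graph (Fin 4 × Fin k)
Z k = record { Adj = ZAdj ; sym = ZAdj-sym ; irrefl = ZAdj-irr }

{-# OPTIONS --safe #-}
-- Both sides of the equivalence say that G is a blow-up of the path a–b–c–d in which a and d
-- become independent sets and b and c cliques. In a split graph a rectangle partition is such a
-- blow-up: the side of one vertex of V₁ propagates around V₁ → V₂ → V₄ → V₃ → V₁, after
-- possibly relabelling the partition as (V₂, V₁, V₄, V₃). Since the pattern separates any two
-- blocks, the blocks are exactly the classes of twins, so an isomorphism F onto the complement
-- permutes them by a map σ that turns the pattern into its complement. Such a σ is a 4-cycle,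
-- and F embeds every block into its image under σ; hence block sizes never decrease around the
-- cycle, so they are all equal to some k, and G ≅ Z_k.
module Submission where

open import Defs renaming (sym to Adj-sym)
open import Data.Nat using (ℕ; zero; suc; _+_; _≤_; _<_)
open import Data.Nat.Base using (>-nonZero⁻¹)
open import Data.Nat.Properties using (≤-refl; ≤-trans; ≤-antisym)
open import Data.Nat.GeneralisedArithmetic using (iterate)
open import Data.Fin using (Fin; zero; suc; toℕ; _≟_)
open import Data.Fin.Properties using (all?; any?; injective⇒≤; +↔⊎; nonZeroIndex)
open import Data.Bool using (Bool; true; false; not; T; if_then_else_)
open import Data.Bool.Properties using (not-injective) renaming (_≟_ to _≟ᵇ_)
open import Data.Product using (_×_; ∃; Σ; _,_; proj₁; proj₂)
open import Data.Sum using (_⊎_; inj₁; inj₂)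
open import Data.Sum.Function.Propositional using (_⊎-↔_)
open import Data.Unit using (tt)
open import Data.Empty using (⊥-elim)
open import Function using (_∘_)
open import Function.Bundles
  using (_⇔_; mk⇔; Equivalence; _↔_; mk↔ₛ′; Inverse; Bijection; _↣_; mk↣; Injection)
open import Function.Construct.Composition using (_↣-∘_)
open import Function.Properties.Equivalence using () renaming (trans to ⇔-trans; sym to ⇔-sym)
open import Function.Properties.Inverse using (↔-sym; ↔-trans; ↔⇒⤖; ↔⇒↣)
open import Function.Related.TypeIsomorphisms using (¬-cong-⇔)
open import Relation.Binary using (DecidableEquality)
open import Relation.Binary.PropositionalEquality
  using (_≡_; _≢_; _≗_; refl; sym; trans; cong; subst; subst₂)
open import Relation.Binary.PropositionalEquality.WithK using (≡-irrelevant)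
open import Relation.Nullary using (¬_; Dec; yes; no; does; ¬?)
import Relation.Nullary as Nullary
open import Relation.Nullary.Decidable using (from-yes; decidable-stable; _→-dec_; _×-dec_)
import Relation.Unary as U

bit : ∀ {A : Set} → Dec A → ℕ
bit a? = if does a? then 1 else 0

count : ∀ {n} {P : Fin n → Set} → U.Decidable P → ℕ
count {zero}  P? = 0
count {suc n} P? = bit (P? zero) + count (P? ∘ suc)

Dec↔Fin-bit : ∀ {A : Set} → Nullary.Irrelevant A → (a? : Dec A) → A ↔ Fin (bit a?)
Dec↔Fin-bit irr (yes x) = mk↔ₛ′ (λ _ → zero) (λ _ → x) (λ { zero → refl }) (irr x)
Dec↔Fin-bit irr (no ¬x) = mk↔ₛ′ (⊥-elim ∘ ¬x) (λ ()) (λ ()) (⊥-elim ∘ ¬x)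

Σ-Fin-suc↔⊎ : ∀ {n} (P : Fin (suc n) → Set) → Σ (Fin (suc n)) P ↔ (P zero ⊎ Σ (Fin n) (P ∘ suc))
Σ-Fin-suc↔⊎ P = mk↔ₛ′ to from to∘from from∘to
  where
  to : Σ _ P → P zero ⊎ Σ _ (P ∘ suc)
  to (zero , x) = inj₁ x
  to (suc i , x) = inj₂ (i , x)
  from : P zero ⊎ Σ _ (P ∘ suc) → Σ _ P
  from (inj₁ x) = zero , x
  from (inj₂ (i , x)) = suc i , x
  to∘from : ∀ y → to (from y) ≡ y
  to∘from (inj₁ _) = refl
  to∘from (inj₂ _) = refl
  from∘to : ∀ x → from (to x) ≡ x
  from∘to (zero , _) = refl
  from∘to (suc _ , _) = refl

Σ↔Fin-count : ∀ {n} {P : Fin n → Set} → U.Irrelevant P → (P? : U.Decidable P) →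
              Σ (Fin n) P ↔ Fin (count P?)
Σ↔Fin-count {zero}  irr P? = mk↔ₛ′ (λ ()) (λ ()) (λ ()) (λ ())
Σ↔Fin-count {suc n} irr P? =
  ↔-trans (Σ-Fin-suc↔⊎ _)
    (↔-trans (Dec↔Fin-bit irr (P? zero) ⊎-↔ Σ↔Fin-count irr (P? ∘ suc)) (↔-sym +↔⊎))

↣⇒≤ : ∀ {A B : Set} {m n} → A ↔ Fin m → B ↔ Fin n → A ↣ B → m ≤ n
↣⇒≤ A↔ B↔ f = injective⇒≤ (Injection.injective (↔⇒↣ B↔ ↣-∘ (f ↣-∘ ↔⇒↣ (↔-sym A↔))))

Fibre : ∀ {A B : Set} → (A → B) → B → Set
Fibre β y = ∃ λ x → β x ≡ y

Fibre-≡ : ∀ {A B : Set} {β : A → B} {y} {p q : Fibre β y} → proj₁ p ≡ proj₁ q → p ≡ q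
Fibre-≡ {p = x , e} {q = .x , e′} refl = cong (x ,_) (≡-irrelevant e e′)

fibres↔× : ∀ {A B C : Set} (β : A → B) → (∀ y → Fibre β y ↔ C) → A ↔ (B × C)
fibres↔× {A} {B} {C} β e = mk↔ₛ′ to from to∘from from∘to
  where
  to : A → B × C
  to x = β x , Inverse.to (e (β x)) (x , refl)
  from : B × C → A
  from (y , z) = proj₁ (Inverse.from (e y) z)
  to∘from : ∀ yz → to (from yz) ≡ yz
  to∘from (y , z) with Inverse.from (e y) z | Inverse.strictlyInverseˡ (e y) z
  ... | x , refl | eq = cong (β x ,_) eq
  from∘to : ∀ x → from (to x) ≡ x
  from∘to x = cong proj₁ (Inverse.strictlyInverseʳ (e (β x)) (x , refl))

SingleOrbit : ∀ {A : Set} → (A → A) → Set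
SingleOrbit f = ∀ x y → ∃ λ j → iterate f x j ≡ y

iterate-≗ : ∀ {A : Set} {f g : A → A} → f ≗ g → ∀ x j → iterate f x j ≡ iterate g x j
iterate-≗ f≗g x zero = refl
iterate-≗ {g = g} f≗g x (suc j) =
  trans (iterate-≗ f≗g _ j) (cong (λ y → iterate g y j) (f≗g x))

≤-iterate : ∀ {A : Set} (c : A → ℕ) {f : A → A} → (∀ x → c x ≤ c (f x)) →
            ∀ x j → c x ≤ c (iterate f x j)
≤-iterate c mono x zero = ≤-refl
≤-iterate c mono x (suc j) = ≤-trans (mono x) (≤-iterate c mono _ j)

single-orbit⇒constant : ∀ {A : Set} (c : A → ℕ) {f : A → A} → (∀ x → c x ≤ c (f x)) →
                         SingleOrbit f → ∀ x y → c x ≡ c y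
single-orbit⇒constant c mono orbit x y = ≤-antisym (reach x y) (reach y x)
  where
  reach : ∀ x y → c x ≤ c y
  reach x y with orbit x y
  ... | j , refl = ≤-iterate c mono x j

T-injective : ∀ {x y} → T x ⇔ T y → x ≡ y
T-injective {false} {false} _ = refl
T-injective {false} {true}  e = ⊥-elim (Equivalence.from e tt)
T-injective {true}  {false} e = ⊥-elim (Equivalence.to e tt)
T-injective {true}  {true}  _ = refl

T-not : ∀ x → T (not x) ⇔ (¬ T x)
T-not false = mk⇔ (λ _ ()) (λ _ → tt)
T-not true  = mk⇔ (λ ()) (λ ¬t → ¬t tt)

Twins : ∀ {V} → Graph V → V → V → Set
Twins G x y = ∀ w → w ≢ x → w ≢ y → Adj G x w ⇔ Adj G y w

Twins-transport : ∀ {V W} {G : Graph V} {H : Graph W} ((f , _) : G ≅ H) {x y} →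
                  Twins G x y → Twins H (Bijection.to f x) (Bijection.to f y)
Twins-transport (f , adj) {x} {y} tw w w≢fx w≢fy with Bijection.strictlySurjective f w
... | u , refl =
  ⇔-trans (⇔-sym (adj x u))
    (⇔-trans (tw u (w≢fx ∘ cong (Bijection.to f)) (w≢fy ∘ cong (Bijection.to f))) (adj y u))

-- The diagonal entry M X X says whether block X is a clique or an independent set.
IsBlowUp : ∀ {V B : Set} → Graph V → (B → B → Bool) → (V → B) → Set
IsBlowUp G M β = ∀ u v → u ≢ v → Adj G u v ⇔ T (M (β u) (β v))

Separating : ∀ {B : Set} → (B → B → Bool) → Set
Separating M = ∀ X Y → X ≢ Y → ∃ λ Z → Z ≢ X × Z ≢ Y × M X Z ≢ M Y Z

Antimorphism : ∀ {B : Set} → (B → B → Bool) → (B → B) → Set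
Antimorphism M σ = ∀ X Y → X ≢ Y → M X Y ≡ not (M (σ X) (σ Y))

module _ {V B : Set} {G : Graph V} {M : B → B → Bool} {β : V → B} where

  complement-IsBlowUp : IsBlowUp G M β → IsBlowUp (complement G) (λ X Y → not (M X Y)) β
  complement-IsBlowUp blowUp u v u≢v =
    ⇔-trans (mk⇔ proj₂ (u≢v ,_)) (⇔-trans (¬-cong-⇔ (blowUp u v u≢v)) (⇔-sym (T-not _)))

  ≡-block⇒Twins : IsBlowUp G M β → ∀ {x y} → β x ≡ β y → Twins G x y
  ≡-block⇒Twins blowUp {x} {y} βx≡βy w w≢x w≢y =
    ⇔-trans (blowUp x w (w≢x ∘ sym))
      (subst (λ X → T (M X (β w)) ⇔ Adj G y w) (sym βx≡βy) (⇔-sym (blowUp y w (w≢y ∘ sym))))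

  Twins⇒≡-block : DecidableEquality B → IsBlowUp G M β → (∀ X → Fibre β X) →
                  Separating M → ∀ {x y} → Twins G x y → β x ≡ β y
  Twins⇒≡-block _≟ᴮ_ blowUp cover separating {x} {y} tw =
    decidable-stable (β x ≟ᴮ β y) λ βx≢βy → separated (separating _ _ βx≢βy)
    where
    separated : ¬ ∃ λ Z → Z ≢ β x × Z ≢ β y × M (β x) Z ≢ M (β y) Z
    separated (Z , Z≢βx , Z≢βy , differ) with cover Z
    ... | w , refl = differ (T-injective
      (⇔-trans (⇔-sym (blowUp x w (w≢x ∘ sym))) (⇔-trans (tw w w≢x w≢y) (blowUp y w (w≢y ∘ sym)))))
      where
      w≢x : w ≢ x
      w≢x = Z≢βx ∘ cong β
      w≢y : w ≢ y
      w≢y = Z≢βy ∘ cong β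

Separating-not : ∀ {B : Set} {M : B → B → Bool} → Separating M → Separating (λ X Y → not (M X Y))
Separating-not separating X Y X≢Y with separating X Y X≢Y
... | Z , Z≢X , Z≢Y , differ = Z , Z≢X , Z≢Y , differ ∘ not-injective

blowUps-≅ : ∀ {V W B : Set} {G : Graph V} {H : Graph W} {M : B → B → Bool} {β γ} →
            DecidableEquality V → IsBlowUp G M β → IsBlowUp H M γ →
            (f : V ↔ W) → (∀ u → γ (Inverse.to f u) ≡ β u) → G ≅ H
blowUps-≅ {G = G} {H} {M} _≟ⱽ_ blowUpG blowUpH f γ∘f≡β = ↔⇒⤖ f , adj
  where
  open Bijection (↔⇒⤖ f) using (to; injective)
  adj : ∀ u v → Adj G u v ⇔ Adj H (to u) (to v)
  adj u v with u ≟ⱽ v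
  ... | yes refl = mk⇔ (⊥-elim ∘ irrefl G) (⊥-elim ∘ irrefl H)
  ... | no u≢v = ⇔-trans (blowUpG u v u≢v)
    (subst₂ (λ X Y → T (M X Y) ⇔ Adj H (to u) (to v)) (γ∘f≡β u) (γ∘f≡β v)
      (⇔-sym (blowUpH (to u) (to v) (u≢v ∘ injective))))

module SelfComplementaryBlowUp
  {V B : Set} {G : Graph V} {M : B → B → Bool} {β : V → B}
  (_≟ᴮ_ : DecidableEquality B) (blowUp : IsBlowUp G M β) (cover : ∀ X → Fibre β X)
  (separating : Separating M) (sc : SelfComplementary G) where

  F : V → V
  F = Bijection.to (proj₁ sc)

  complement-blowUp : IsBlowUp (complement G) (λ X Y → not (M X Y)) β
  complement-blowUp = complement-IsBlowUp {G = G} {M = M} {β = β} blowUp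

  F-respects-blocks : ∀ {u v} → β u ≡ β v → β (F u) ≡ β (F v)
  F-respects-blocks βu≡βv =
    Twins⇒≡-block {G = complement G} _≟ᴮ_ complement-blowUp cover (Separating-not separating)
      (Twins-transport {G = G} {H = complement G} sc (≡-block⇒Twins {G = G} {M = M} blowUp βu≡βv))

  blockMap : B → B
  blockMap X = β (F (proj₁ (cover X)))

  β∘F : ∀ u → β (F u) ≡ blockMap (β u)
  β∘F u = F-respects-blocks (sym (proj₂ (cover (β u))))

  blockMap-antimorphism : Antimorphism M blockMap
  blockMap-antimorphism X Y X≢Y with cover X | cover Y
  ... | x , refl | y , refl = T-injective (⇔-trans (⇔-sym (blowUp x y x≢y))
    (⇔-trans (proj₂ sc x y) (complement-blowUp (F x) (F y) (x≢y ∘ Bijection.injective (proj₁ sc)))))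
    where
    x≢y : x ≢ y
    x≢y = X≢Y ∘ cong β

  F-on-fibre : ∀ X → Fibre β X ↣ Fibre β (blockMap X)
  F-on-fibre X = mk↣ {to = to} (Fibre-≡ ∘ Bijection.injective (proj₁ sc) ∘ cong proj₁)
    where
    to : Fibre β X → Fibre β (blockMap X)
    to (u , βu≡X) = F u , trans (β∘F u) (cong blockMap βu≡X)

pattern a = zero
pattern b = suc zero
pattern c = suc (suc zero)
pattern d = suc (suc (suc zero))

joined : Fin 4 → Fin 4 → Bool
joined a b = true
joined b a = true
joined b b = true
joined b c = true
joined c b = true
joined c c = true
joined c d = true
joined d c = true
joined _ _ = false

JoinedBlowUp : ∀ {V} → Graph V → Set
JoinedBlowUp {V} G = Σ (V → Fin 4) λ β → (∀ X → Fibre β X) × IsBlowUp G joined β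

Z-IsBlowUp : ∀ {k} → IsBlowUp (Z k) joined proj₁
Z-IsBlowUp (a , _) (a , _) _ = mk⇔ (λ ()) (λ ())
Z-IsBlowUp (a , _) (b , _) _ = mk⇔ _ _
Z-IsBlowUp (a , _) (c , _) _ = mk⇔ (λ ()) (λ ())
Z-IsBlowUp (a , _) (d , _) _ = mk⇔ (λ ()) (λ ())
Z-IsBlowUp (b , _) (a , _) _ = mk⇔ _ _
Z-IsBlowUp (b , _) (b , _) u≢v = mk⇔ _ (λ _ → u≢v ∘ cong (b ,_))
Z-IsBlowUp (b , _) (c , _) _ = mk⇔ _ _
Z-IsBlowUp (b , _) (d , _) _ = mk⇔ (λ ()) (λ ())
Z-IsBlowUp (c , _) (a , _) _ = mk⇔ (λ ()) (λ ())
Z-IsBlowUp (c , _) (b , _) _ = mk⇔ _ _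
Z-IsBlowUp (c , _) (c , _) u≢v = mk⇔ _ (λ _ → u≢v ∘ cong (c ,_))
Z-IsBlowUp (c , _) (d , _) _ = mk⇔ _ _
Z-IsBlowUp (d , _) (a , _) _ = mk⇔ (λ ()) (λ ())
Z-IsBlowUp (d , _) (b , _) _ = mk⇔ (λ ()) (λ ())
Z-IsBlowUp (d , _) (c , _) _ = mk⇔ _ _
Z-IsBlowUp (d , _) (d , _) _ = mk⇔ (λ ()) (λ ())

-- Decided by evaluation, as is the next opaque block; opaque keeps later type checking from
-- unfolding the decision procedure again.
opaque
  joined-separating : Separating joined
  joined-separating = from-yes (all? λ X → all? λ Y → ¬? (X ≟ Y) →-dec
    any? λ Z → ¬? (Z ≟ X) ×-dec ¬? (Z ≟ Y) ×-dec ¬? (joined X Z ≟ᵇ joined Y Z))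

fromValues : Fin 4 → Fin 4 → Fin 4 → Fin 4 → Fin 4 → Fin 4
fromValues σa σb σc σd a = σa
fromValues σa σb σc σd b = σb
fromValues σa σb σc σd c = σc
fromValues σa σb σc σd d = σd

fromValues-≗ : ∀ σ → fromValues (σ a) (σ b) (σ c) (σ d) ≗ σ
fromValues-≗ σ a = refl
fromValues-≗ σ b = refl
fromValues-≗ σ c = refl
fromValues-≗ σ d = refl

Antimorphism-≗ : ∀ {B : Set} {M : B → B → Bool} {σ τ} → σ ≗ τ → Antimorphism M σ → Antimorphism M τ
Antimorphism-≗ {M = M} σ≗τ anti X Y X≢Y =
  subst₂ (λ σX σY → M X Y ≡ not (M σX σY)) (σ≗τ X) (σ≗τ Y) (anti X Y X≢Y)

-- The antimorphisms are exactly the 4-cycles a → c → d → b → a and a → b → d → c → a.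
opaque
  joined-antimorphisms-of-fromValues : ∀ σa σb σc σd → Antimorphism joined (fromValues σa σb σc σd) →
    ∀ X Y → ∃ λ (j : Fin 4) → iterate (fromValues σa σb σc σd) X (toℕ j) ≡ Y
  joined-antimorphisms-of-fromValues = from-yes (all? λ σa → all? λ σb → all? λ σc → all? λ σd →
    all? (λ X → all? λ Y → ¬? (X ≟ Y) →-dec
      (joined X Y ≟ᵇ not (joined (fromValues σa σb σc σd X) (fromValues σa σb σc σd Y))))
    →-dec all? λ X → all? λ Y → any? λ (j : Fin 4) → iterate (fromValues σa σb σc σd) X (toℕ j) ≟ Y)

joined-antimorphism⇒single-orbit : ∀ σ → Antimorphism joined σ → SingleOrbit σ
joined-antimorphism⇒single-orbit σ anti X Y =
  let j , orbit = joined-antimorphisms-of-fromValues (σ a) (σ b) (σ c) (σ d)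
                    (Antimorphism-≗ (sym ∘ fromValues-≗ σ) anti) X Y
  in toℕ j , trans (iterate-≗ (sym ∘ fromValues-≗ σ) X (toℕ j)) orbit

module SelfComplementaryJoinedBlowUp {n} {G : FinGraph n} {β : Fin n → Fin 4}
  (blowUp : IsBlowUp G joined β) (cover : ∀ X → Fibre β X) (sc : SelfComplementary G) where

  open SelfComplementaryBlowUp {G = G} {M = joined} {β = β} _≟_ blowUp cover joined-separating sc

  size : Fin 4 → ℕ
  size X = count (λ u → β u ≟ X)

  Fibre↔Fin-size : ∀ X → Fibre β X ↔ Fin (size X)
  Fibre↔Fin-size X = Σ↔Fin-count ≡-irrelevant (λ u → β u ≟ X)

  size-equal : ∀ X → size X ≡ size a
  size-equal X = single-orbit⇒constant size
    (λ Y → ↣⇒≤ (Fibre↔Fin-size Y) (Fibre↔Fin-size (blockMap Y)) (F-on-fibre Y))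
    (joined-antimorphism⇒single-orbit blockMap blockMap-antimorphism) X a

  k : ℕ
  k = size a

  0<k : 0 < k
  0<k = >-nonZero⁻¹ k {{nonZeroIndex (Inverse.to (Fibre↔Fin-size a) (cover a))}}

  Fin-n↔Fin-4×Fin-k : Fin n ↔ (Fin 4 × Fin k)
  Fin-n↔Fin-4×Fin-k = fibres↔× β λ X → subst (λ m → Fibre β X ↔ Fin m) (size-equal X) (Fibre↔Fin-size X)

  G≅Z-k : G ≅ Z k
  G≅Z-k = blowUps-≅ {G = G} {H = Z k} {M = joined} {γ = proj₁} _≟_ blowUp Z-IsBlowUp Fin-n↔Fin-4×Fin-k (λ _ → refl)

module SplitRectangleParts {V : Set} {G : Graph V} (side : V → Side)
  (clique-adj : ∀ u v → side u ≡ clique → side v ≡ clique → u ≢ v → Adj G u v)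
  (indep-nonadj : ∀ u v → side u ≡ indep → side v ≡ indep → ¬ Adj G u v)
  (p : V → Fin 4) (nonempty : ∀ X → Fibre p X)
  (V₁V₂ : ∀ u v → p u ≡ a → p v ≡ b → Adj G u v)
  (V₁V₃ : ∀ u v → p u ≡ a → p v ≡ c → ¬ Adj G u v)
  (V₄V₃ : ∀ u v → p u ≡ d → p v ≡ c → Adj G u v)
  (V₄V₂ : ∀ u v → p u ≡ d → p v ≡ b → ¬ Adj G u v) where

  neighbour-of-indep : ∀ {u v} → side u ≡ indep → Adj G u v → side v ≡ clique
  neighbour-of-indep {u} {v} su uv with side v in sv
  ... | clique = refl
  ... | indep  = ⊥-elim (indep-nonadj u v su sv uv)

  non-neighbour-of-clique : ∀ {u v} → side u ≡ clique → u ≢ v → ¬ Adj G u v → side v ≡ indep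
  non-neighbour-of-clique {u} {v} su u≢v ¬uv with side v in sv
  ... | indep  = refl
  ... | clique = ⊥-elim (¬uv (clique-adj u v su sv u≢v))

  edge : ∀ {A : Set} → A → A ⇔ T true
  edge x = mk⇔ _ (λ _ → x)

  non-edge : ∀ {A : Set} → ¬ A → A ⇔ T false
  non-edge ¬x = mk⇔ ¬x (λ ())

  label-≢ : ∀ {u v X Y} → p u ≡ X → p v ≡ Y → X ≢ Y → u ≢ v
  label-≢ pu pv X≢Y refl = X≢Y (trans (sym pu) pv)

  rep : Fin 4 → V
  rep X = proj₁ (nonempty X)

  rep-label : ∀ X → p (rep X) ≡ X
  rep-label X = proj₂ (nonempty X)

  indep-V₁-or-V₂ : side (rep a) ≡ indep ⊎ side (rep b) ≡ indep
  indep-V₁-or-V₂ with side (rep a) in s₁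
  ... | indep  = inj₁ refl
  ... | clique = inj₂ (non-neighbour-of-clique s₄ (label-≢ (rep-label d) (rep-label b) (λ ()))
                         (V₄V₂ _ _ (rep-label d) (rep-label b)))
    where
    s₃ : side (rep c) ≡ indep
    s₃ = non-neighbour-of-clique s₁ (label-≢ (rep-label a) (rep-label c) (λ ()))
      (V₁V₃ _ _ (rep-label a) (rep-label c))
    s₄ : side (rep d) ≡ clique
    s₄ = neighbour-of-indep s₃ (Adj-sym G (V₄V₃ _ _ (rep-label d) (rep-label c)))

  module _ (s₁ : side (rep a) ≡ indep) where

    V₂-clique : ∀ {v} → p v ≡ b → side v ≡ clique
    V₂-clique pv = neighbour-of-indep s₁ (V₁V₂ _ _ (rep-label a) pv)

    V₄-indep : ∀ {v} → p v ≡ d → side v ≡ indep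
    V₄-indep pv = non-neighbour-of-clique (V₂-clique (rep-label b))
      (label-≢ (rep-label b) pv (λ ())) (V₄V₂ _ _ pv (rep-label b) ∘ Adj-sym G)

    V₃-clique : ∀ {v} → p v ≡ c → side v ≡ clique
    V₃-clique pv = neighbour-of-indep (V₄-indep (rep-label d)) (V₄V₃ _ _ (rep-label d) pv)

    V₁-indep : ∀ {v} → p v ≡ a → side v ≡ indep
    V₁-indep pv = non-neighbour-of-clique (V₃-clique (rep-label c))
      (label-≢ (rep-label c) pv (λ ())) (V₁V₃ _ _ pv (rep-label c) ∘ Adj-sym G)

    indep-V₁⇒IsBlowUp : IsBlowUp G joined p
    indep-V₁⇒IsBlowUp u v u≢v with p u in pu | p v in pv
    ... | a | a = non-edge (indep-nonadj u v (V₁-indep pu) (V₁-indep pv))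
    ... | a | b = edge (V₁V₂ u v pu pv)
    ... | a | c = non-edge (V₁V₃ u v pu pv)
    ... | a | d = non-edge (indep-nonadj u v (V₁-indep pu) (V₄-indep pv))
    ... | b | a = edge (Adj-sym G (V₁V₂ v u pv pu))
    ... | b | b = edge (clique-adj u v (V₂-clique pu) (V₂-clique pv) u≢v)
    ... | b | c = edge (clique-adj u v (V₂-clique pu) (V₃-clique pv) u≢v)
    ... | b | d = non-edge (V₄V₂ v u pv pu ∘ Adj-sym G)
    ... | c | a = non-edge (V₁V₃ v u pv pu ∘ Adj-sym G)
    ... | c | b = edge (clique-adj u v (V₃-clique pu) (V₂-clique pv) u≢v)
    ... | c | c = edge (clique-adj u v (V₃-clique pu) (V₃-clique pv) u≢v)
    ... | c | d = edge (Adj-sym G (V₄V₃ v u pv pu))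
    ... | d | a = non-edge (indep-nonadj u v (V₄-indep pu) (V₁-indep pv))
    ... | d | b = non-edge (V₄V₂ u v pu pv)
    ... | d | c = edge (V₄V₃ u v pu pv)
    ... | d | d = non-edge (indep-nonadj u v (V₄-indep pu) (V₄-indep pv))

    indep-V₁⇒JoinedBlowUp : JoinedBlowUp G
    indep-V₁⇒JoinedBlowUp = p , nonempty , indep-V₁⇒IsBlowUp

module SplitRectangle {V : Set} {G : Graph V} (split : IsSplit G) (rect : HasRectanglePartition G) =
  SplitRectangleParts {G = G} (proj₁ split) (proj₁ (proj₂ split)) (proj₂ (proj₂ split))
    (proj₁ rect) (proj₁ (proj₂ rect)) (proj₁ (proj₂ (proj₂ rect))) (proj₁ (proj₂ (proj₂ (proj₂ rect))))
    (proj₁ (proj₂ (proj₂ (proj₂ (proj₂ rect))))) (proj₂ (proj₂ (proj₂ (proj₂ (proj₂ rect)))))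

swap : Fin 4 → Fin 4
swap a = b
swap b = a
swap c = d
swap d = c

swap-≡ : ∀ {X Y} → swap X ≡ Y → X ≡ swap Y
swap-≡ {a} refl = refl
swap-≡ {b} refl = refl
swap-≡ {c} refl = refl
swap-≡ {d} refl = refl

swap-rectangle : ∀ {V} {G : Graph V} → HasRectanglePartition G → HasRectanglePartition G
swap-rectangle {G = G} (p , nonempty , V₁V₂ , V₁V₃ , V₄V₃ , V₄V₂) =
  swap ∘ p , nonempty′ ,
  (λ u v pu pv → Adj-sym G (V₁V₂ v u (swap-≡ pv) (swap-≡ pu))) ,
  (λ u v pu pv → V₄V₂ v u (swap-≡ pv) (swap-≡ pu) ∘ Adj-sym G) ,
  (λ u v pu pv → Adj-sym G (V₄V₃ v u (swap-≡ pv) (swap-≡ pu))) ,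
  (λ u v pu pv → V₁V₃ v u (swap-≡ pv) (swap-≡ pu) ∘ Adj-sym G)
  where
  nonempty′ : ∀ X → Fibre (swap ∘ p) X
  nonempty′ X = proj₁ (nonempty (swap X)) , sym (swap-≡ (sym (proj₂ (nonempty (swap X)))))

split-rectangle⇒JoinedBlowUp : ∀ {V} {G : Graph V} → IsSplit G → HasRectanglePartition G →
                               JoinedBlowUp G
split-rectangle⇒JoinedBlowUp {G = G} split rect with SplitRectangle.indep-V₁-or-V₂ {G = G} split rect
... | inj₁ s₁ = SplitRectangle.indep-V₁⇒JoinedBlowUp {G = G} split rect s₁
... | inj₂ s₂ = SplitRectangle.indep-V₁⇒JoinedBlowUp {G = G} split (swap-rectangle {G = G} rect) s₂

rectangle-transport : ∀ {V W} {G : Graph V} {H : Graph W} → G ≅ H →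
                      HasRectanglePartition H → HasRectanglePartition G
rectangle-transport (f , adj) (p , nonempty , V₁V₂ , V₁V₃ , V₄V₃ , V₄V₂) =
  p ∘ to , nonempty′ ,
  (λ u v pu pv → Equivalence.from (adj u v) (V₁V₂ _ _ pu pv)) ,
  (λ u v pu pv → V₁V₃ _ _ pu pv ∘ Equivalence.to (adj u v)) ,
  (λ u v pu pv → Equivalence.from (adj u v) (V₄V₃ _ _ pu pv)) ,
  (λ u v pu pv → V₄V₂ _ _ pu pv ∘ Equivalence.to (adj u v))
  where
  open Bijection f using (to; strictlySurjective)
  nonempty′ : ∀ X → Fibre (p ∘ to) X
  nonempty′ X with strictlySurjective (proj₁ (nonempty X))
  ... | u , fu≡w = u , trans (cong p fu≡w) (proj₂ (nonempty X))

Z-rectangle : ∀ {k} → 0 < k → HasRectanglePartition (Z k)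
Z-rectangle {suc k} _ =
  proj₁ , (λ X → (X , zero) , refl) ,
  (λ { (_ , _) (_ , _) refl refl → tt }) ,
  (λ { (_ , _) (_ , _) refl refl () }) ,
  (λ { (_ , _) (_ , _) refl refl → tt }) ,
  (λ { (_ , _) (_ , _) refl refl () })

lemma9 : (n : ℕ) (G : FinGraph n) → SelfComplementary G → IsSplit G →
         (HasRectanglePartition G ⇔ ∃ λ k → 0 < k × G ≅ Z k)
lemma9 n G sc split = mk⇔ forward backward
  where
  forward : HasRectanglePartition G → ∃ λ k → 0 < k × G ≅ Z k
  forward rect with split-rectangle⇒JoinedBlowUp {G = G} split rect
  ... | β , cover , blowUp = k , 0<k , G≅Z-k
    where open SelfComplementaryJoinedBlowUp {G = G} {β = β} blowUp cover sc
  backward : (∃ λ k → 0 < k × G ≅ Z k) → HasRectanglePartition G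
  backward (k , 0<k , G≅Z) = rectangle-transport {G = G} {H = Z k} G≅Z (Z-rectangle 0<k)
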